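{- Let $G$ be a graph, $(T,\chi)$ an extreme lenient tree decomposition of $G$ of width $k$, and $G^+$ the $(T,\chi)$-completion of $G$. If $S$ is a minimal $(x,y)$-separator of $G^+$ for some $x,y$, then there is a node $t\in V(T)$ with $S=\chi(t)$.
   Context: Lenient tree decomposition: $(T,\chi)$, $T$ a tree, $\chi:V(T)\to 2^{V(G)}$, with (C1) bags covering $V(G)$; (C2) every edge $e$ of $G$ satisfies $e\subseteq\chi(t)\cup\chi(t')$ for some close nodes $t,t'$ (equal or adjacent); (C3) $\{t:x\in\chi(t)\}$ is connected in $T$ for every $x$. Width: $\max_t|\chi(t)|$. For a leaf $t$ with neighbour $t'$, ${\sf Petal}(t)=\chi(t)\setminus\chi(t')$. Extreme (of width $k$): all bags have equal size; no bag is a subset of another; for every degree-2 node $t$ and nodes $t',t''$ with $t$ on the $t'$–$t''$ path, $\chi(t)\not\subseteq\chi(t')\cup\chi(t'')$; for distinct leaf neighbours $t',t''$ of any node, $|{\sf Petal}(t')\cup{\sf Petal}(t'')|>k$. The $(T,\chi)$-completion $G^+$ has vertex set $V(G)$ and edge set $\bigcup\binom{\chi(t)\cup\chi(t')}{2}$ over close pairs. $S$ is an $(x,y)$-separator if $x,y$ are in different components of $G^+-S$; minimal if no proper subset is one. -}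

module Defs where

open import Data.Nat using (ℕ; _<_)
open import Data.Fin using (Fin)
open import Data.Fin.Subset using (Subset; _∈_; _∉_; _⊆_; _⊂_; _∪_; _─_; ∣_∣)
open import Data.List using (List; []; _∷_)
open import Data.List.Membership.Propositional using () renaming (_∈_ to _∈ₗ_)
open import Data.List.Relation.Unary.All using (All)
open import Data.List.Relation.Unary.Unique.Propositional using (Unique)
open import Data.Product using (Σ; ∃; _×_; _,_)
open import Data.Sum using (_⊎_)
open import Relation.Nullary using (¬_)
open import Relation.Binary.PropositionalEquality using (_≡_; _≢_)

record Graph : Set₁ where
  field
    n      : ℕ
    E      : Fin n → Fin n → Set
    sym    : ∀ {u v} → E u v → E v u
    irrefl : ∀ {u} → ¬ E u u

-- Walks given by the list of visited vertices (both endpoints included)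

data Walk {m : ℕ} (A : Fin m → Fin m → Set) : Fin m → Fin m → List (Fin m) → Set where
  here : ∀ {s} → Walk A s s (s ∷ [])
  step : ∀ {s u t p} → A s u → Walk A u t p → Walk A s t (s ∷ p)

IsPath : {m : ℕ} (A : Fin m → Fin m → Set) → Fin m → Fin m → List (Fin m) → Set
IsPath A s t p = Walk A s t p × Unique p

record Tree : Set₁ where
  field
    m        : ℕ
    adj      : Fin m → Fin m → Set
    sym      : ∀ {s t} → adj s t → adj t s
    irrefl   : ∀ {s} → ¬ adj s s
    path     : ∀ s t → ∃ λ p → IsPath adj s t p
    pathUniq : ∀ {s t p q} → IsPath adj s t p → IsPath adj s t q → p ≡ q

module _ (T : Tree) where
  open Tree T

  Close : Fin m → Fin m → Set
  Close t t' = t ≡ t' ⊎ adj t t'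

  LeafWithNbr : Fin m → Fin m → Set
  LeafWithNbr t t' = adj t t' × (∀ s → adj t s → s ≡ t')

  Degree2 : Fin m → Set
  Degree2 t = Σ (Fin m) λ a → Σ (Fin m) λ b →
    a ≢ b × adj t a × adj t b × (∀ s → adj t s → s ≡ a ⊎ s ≡ b)

  OnPath : Fin m → Fin m → Fin m → Set
  OnPath t t' t'' = ∀ p → IsPath adj t' t'' p → t ∈ₗ p

module _ (G : Graph) (T : Tree) where
  open Graph G
  open Tree T renaming (sym to symT)

  Bags : Set
  Bags = Fin m → Subset n

  record IsLenientTD (χ : Bags) : Set where
    field
      cover : ∀ (x : Fin n) → ∃ λ t → x ∈ χ t
      edges : ∀ {u v} → E u v → ∃ λ t → ∃ λ t' →
                Close T t t' × u ∈ (χ t ∪ χ t') × v ∈ (χ t ∪ χ t')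
      conn  : ∀ (x : Fin n) t t' → x ∈ χ t → x ∈ χ t' →
                ∃ λ p → IsPath adj t t' p × All (λ s → x ∈ χ s) p

  Petal : Bags → Fin m → Fin m → Subset n
  Petal χ t t' = χ t ─ χ t'

  record IsExtreme (k : ℕ) (χ : Bags) : Set where
    field
      lenient   : IsLenientTD χ
      -- all bags have the same size k (hence width k)
      size      : ∀ t → ∣ χ t ∣ ≡ k
      noSubset  : ∀ t t' → t ≢ t' → ¬ (χ t ⊆ χ t')
      deg2      : ∀ t t' t'' → Degree2 T t → t ≢ t' → t ≢ t'' → OnPath T t t' t'' →
                    ¬ (χ t ⊆ (χ t' ∪ χ t''))
      petals    : ∀ s t' t'' → t' ≢ t'' → LeafWithNbr T t' s → LeafWithNbr T t'' s →
                    k < ∣ Petal χ t' s ∪ Petal χ t'' s ∣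

  Completion : Bags → Fin n → Fin n → Set
  Completion χ u v = u ≢ v × (∃ λ t → ∃ λ t' →
    Close T t t' × u ∈ (χ t ∪ χ t') × v ∈ (χ t ∪ χ t'))

data ReachAvoid {n : ℕ} (H : Fin n → Fin n → Set) (S : Subset n) : Fin n → Fin n → Set where
  refl' : ∀ {x} → x ∉ S → ReachAvoid H S x x
  step' : ∀ {x y z} → x ∉ S → H x y → ReachAvoid H S y z → ReachAvoid H S x z

IsSeparator : {n : ℕ} (H : Fin n → Fin n → Set) → Subset n → Fin n → Fin n → Set
IsSeparator H S x y = x ∉ S × y ∉ S × ¬ ReachAvoid H S x y

IsMinimalSeparator : {n : ℕ} (H : Fin n → Fin n → Set) → Subset n → Fin n → Fin n → Set
IsMinimalSeparator H S x y =
  IsSeparator H S x y × (∀ S' → S' ⊂ S → ¬ IsSeparator H S' x y)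

-- Let C be the component of x in G⁺ − S and walk along the tree path from a bag containing x
-- to one containing y. Some bag on it meets C and its successor χ(t) does not. Every vertex of
-- χ(t) outside S would be adjacent in G⁺ to C, so χ(t) ⊆ S. Conversely, if s ∈ S were not in
-- χ(t), minimality gives an x–y walk in G⁺ − (S − s); it runs x ⇝ u ~ s ~ v ⇝ y with both ends
-- in G⁺ − S, and by (C2)/(C3) the bags meeting C ∪ {s} ∪ C_y contain a walk from the bag of x
-- to the bag of y. In a tree such a walk covers the whole path, so χ(t) would meet C, contain s,
-- or meet C_y ⊆ V − S, each impossible.
module Submission where

open import Defs
open import Data.Nat using (ℕ)
open import Data.Fin using (Fin; _≟_)
open import Data.Fin.Subset using (Subset; _∈_; _∉_; _⊆_; _⊂_; _∪_; _-_)
open import Data.Fin.Subset.Properties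
  using (_∈?_; x∈p∪q⁺; x∈p∪q⁻; x∈p∧x≢y⇒x∈p-y; x∈p⇒p-x⊂p; ⊆-antisym)
open import Data.Fin.Properties using (any?)
open import Data.Vec.Properties using (≡-dec)
import Data.Bool as Bool
open import Data.Product using (∃; ∃₂; _×_; _,_; proj₁; proj₂)
open import Data.Sum using (_⊎_; inj₁; inj₂)
open import Data.Empty using (⊥-elim)
open import Function using (_∘_; id)
open import Relation.Nullary using (¬_; yes; no)
open import Relation.Nullary.Decidable using (decidable-stable)
open import Relation.Binary.PropositionalEquality using (_≡_; _≢_; refl; sym; subst)
open import Data.List using (List; []; _∷_)
open import Data.List.Membership.Propositional using () renaming (_∈_ to _∈ₗ_)
open import Data.List.Relation.Binary.Subset.Propositional using () renaming (_⊆_ to _⊆ₗ_)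
open import Data.List.Relation.Unary.Any as Any using (here; there)
open import Data.List.Relation.Unary.All as All using (All; []; _∷_)
open import Data.List.Relation.Unary.All.Properties using (¬Any⇒All¬)
open import Data.List.Relation.Unary.AllPairs using ([]; _∷_)

module _ {n : ℕ} {R : Fin n → Fin n → Set} {S : Subset n} where

  ReachAvoid-source∉ : ∀ {a b} → ReachAvoid R S a b → a ∉ S
  ReachAvoid-source∉ (refl' a∉S)    = a∉S
  ReachAvoid-source∉ (step' a∉S _ _) = a∉S

  ReachAvoid-via : ∀ {a b c d} → ReachAvoid R S a b → R b c → ReachAvoid R S c d → ReachAvoid R S a d
  ReachAvoid-via (refl' a∉S)        e r = step' a∉S e r
  ReachAvoid-via (step' a∉S e' r')  e r = step' a∉S e' (ReachAvoid-via r' e r)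

module _ {n : ℕ} {R : Fin n → Fin n → Set} {S : Subset n} {s : Fin n} where

  private
    ∈-removed : ∀ {z} → z ∈ S → z ∉ S - s → z ≡ s
    ∈-removed {z} z∈S z∉S-s with z ≟ s
    ... | yes z≡s = z≡s
    ... | no  z≢s = ⊥-elim (z∉S-s (x∈p∧x≢y⇒x∈p-y z∈S z≢s))

  -- A walk in R − (S − s) that does not avoid S is cut at its last, respectively first, visit of s.
  ReachAvoid-last-visit : ∀ {a b} → b ∉ S → ReachAvoid R (S - s) a b →
    ReachAvoid R S a b ⊎ ∃ λ v → R s v × ReachAvoid R S v b
  ReachAvoid-last-visit b∉S (refl' _) = inj₁ (refl' b∉S)
  ReachAvoid-last-visit b∉S (step' {x = a} {y = c} a∉S-s e rest)
    with ReachAvoid-last-visit b∉S rest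
  ... | inj₂ later = inj₂ later
  ... | inj₁ c⇝b with a ∈? S
  ...   | no  a∉S = inj₁ (step' a∉S e c⇝b)
  ...   | yes a∈S = inj₂ (c , subst (λ z → R z c) (∈-removed a∈S a∉S-s) e , c⇝b)

  ReachAvoid-first-visit : ∀ {a b} → a ∉ S → ReachAvoid R (S - s) a b →
    ReachAvoid R S a b ⊎ ∃ λ u → ReachAvoid R S a u × R u s
  ReachAvoid-first-visit a∉S (refl' _) = inj₁ (refl' a∉S)
  ReachAvoid-first-visit a∉S (step' {y = c} _ e rest) with c ∈? S
  ... | yes c∈S = inj₂ (_ , refl' a∉S , subst (R _) (∈-removed c∈S (ReachAvoid-source∉ rest)) e)
  ... | no  c∉S with ReachAvoid-first-visit c∉S rest
  ...   | inj₁ c⇝b            = inj₁ (step' a∉S e c⇝b)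
  ...   | inj₂ (u , c⇝u , us) = inj₂ (u , step' a∉S e c⇝u , us)

WalkWithin : ∀ {m} → (Fin m → Fin m → Set) → (Fin m → Set) → Fin m → Fin m → Set
WalkWithin A P a b = ∃ λ p → Walk A a b p × All P p

module _ {m : ℕ} {A : Fin m → Fin m → Set} where

  Walk-source∈ : ∀ {a b p} → Walk A a b p → a ∈ₗ p
  Walk-source∈ here       = here refl
  Walk-source∈ (step _ _) = here refl

  WalkWithin-map : ∀ {P Q : Fin m → Set} {a b} → (∀ {t} → P t → Q t) →
    WalkWithin A P a b → WalkWithin A Q a b
  WalkWithin-map f (p , w , ps) = p , w , All.map f ps

  WalkWithin-++ : ∀ {P : Fin m → Set} {a b c} →
    WalkWithin A P a b → WalkWithin A P b c → WalkWithin A P a c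
  WalkWithin-++ (_ , here , _) w₂ = w₂
  WalkWithin-++ (_ , step e w₁ , pa ∷ ps₁) w₂ with WalkWithin-++ (_ , w₁ , ps₁) w₂
  ... | p , w , ps = _ , step e w , pa ∷ ps

  Path-suffix : ∀ {a b p z} → IsPath A a b p → z ∈ₗ p →
    ∃ λ q → IsPath A z b q × q ⊆ₗ p
  Path-suffix (here     , u) (here refl) = _ , (here , u) , id
  Path-suffix (step e w , u) (here refl) = _ , (step e w , u) , id
  Path-suffix (step e w , _ ∷ u) (there z∈p) with Path-suffix (w , u) z∈p
  ... | q , path , q⊆p = q , path , there ∘ q⊆p

  Walk⇒Path : ∀ {a b p} → Walk A a b p → ∃ λ q → IsPath A a b q × q ⊆ₗ p
  Walk⇒Path here = _ , (here , [] ∷ []) , id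
  Walk⇒Path {a} (step e w) with Walk⇒Path w
  ... | q , path , q⊆p with Any.any? (a ≟_) q
  ...   | yes a∈q with Path-suffix path a∈q
  ...     | r , path′ , r⊆q = r , path′ , there ∘ q⊆p ∘ r⊆q
  Walk⇒Path {a} (step e w) | q , (w′ , u) , q⊆p | no a∉q =
    a ∷ q , (step e w′ , ¬Any⇒All¬ q a∉q ∷ u) , a∷q⊆a∷p
    where
    a∷q⊆a∷p : a ∷ q ⊆ₗ a ∷ _
    a∷q⊆a∷p (here refl)  = here refl
    a∷q⊆a∷p (there z∈q) = there (q⊆p z∈q)

  Walk-crossing : ∀ {Q : Fin m → Set} {a b p} → Walk A a b p → Q a → ¬ Q b →
    ¬ ¬ (∃₂ λ q t → A q t × Q q × ¬ Q t × t ∈ₗ p)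
  Walk-crossing here Qa ¬Qb _ = ¬Qb Qa
  Walk-crossing {Q} (step {u = u} e w) Qa ¬Qb no-crossing = ¬¬Qu ¬Qu
    where
    ¬Qu : ¬ Q u
    ¬Qu Qu = Walk-crossing w Qu ¬Qb
      λ { (q , t , e′ , Qq , ¬Qt , t∈) → no-crossing (q , t , e′ , Qq , ¬Qt , there t∈) }
    ¬¬Qu : ¬ ¬ Q u
    ¬¬Qu ¬Qu = no-crossing (_ , u , e , Qa , ¬Qu , there (Walk-source∈ w))

module _ (T : Tree) where
  open Tree T using (m; adj; pathUniq) renaming (sym to adj-sym)

  Close-sym : ∀ {p q} → Close T p q → Close T q p
  Close-sym (inj₁ refl) = inj₁ refl
  Close-sym (inj₂ e)    = inj₂ (adj-sym e)

  Close-among : ∀ {p q t₁ t₂} → p ≡ t₁ ⊎ p ≡ t₂ → q ≡ t₁ ⊎ q ≡ t₂ → Close T t₁ t₂ → Close T p q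
  Close-among (inj₁ refl) (inj₁ refl) _ = inj₁ refl
  Close-among (inj₁ refl) (inj₂ refl) c = c
  Close-among (inj₂ refl) (inj₁ refl) c = Close-sym c
  Close-among (inj₂ refl) (inj₂ refl) _ = inj₁ refl

  Close⇒WalkWithin : ∀ {p q} → Close T p q → WalkWithin adj (λ z → z ≡ p ⊎ z ≡ q) p q
  Close⇒WalkWithin (inj₁ refl) = _ , here , inj₁ refl ∷ []
  Close⇒WalkWithin (inj₂ e)    = _ , step e here , inj₁ refl ∷ inj₂ refl ∷ []

  WalkWithin⇒Path-within : ∀ {P : Fin m → Set} {a b p} → IsPath adj a b p →
    WalkWithin adj P a b → All P p
  WalkWithin⇒Path-within path (_ , w , Ps) with Walk⇒Path w
  ... | q , path′ , q⊆ with pathUniq path path′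
  ... | refl = All.tabulate (All.lookup Ps ∘ q⊆)

module LenientTD (G : Graph) (T : Tree) (χ : Bags G T) (td : IsLenientTD G T χ) where
  open Graph G using (n)
  open Tree T using (m; adj; path)
  open IsLenientTD td

  G⁺ : Fin n → Fin n → Set
  G⁺ = Completion G T χ

  Meets : (Fin n → Set) → Fin m → Set
  Meets C t = ∃ λ w → C w × w ∈ χ t

  Meets-map : ∀ {C D : Fin n → Set} {t} → (∀ {w} → C w → D w) → Meets C t → Meets D t
  Meets-map f (w , Cw , w∈) = w , f Cw , w∈

  Meets-pair : ∀ {C : Fin n → Set} {a b t} → C a → C b → Meets (λ w → w ≡ a ⊎ w ≡ b) t → Meets C t
  Meets-pair Ca Cb = Meets-map λ { (inj₁ refl) → Ca ; (inj₂ refl) → Cb }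

  close-bags⇒G⁺ : ∀ {a b q t} → Close T q t → a ∈ χ q → b ∈ χ t → a ≢ b → G⁺ a b
  close-bags⇒G⁺ {q = q} {t} c a∈ b∈ a≢b = a≢b , q , t , c , x∈p∪q⁺ (inj₁ a∈) , x∈p∪q⁺ (inj₂ b∈)

  occurrence-walk : ∀ {v t t′} → v ∈ χ t → v ∈ χ t′ → WalkWithin adj (λ q → v ∈ χ q) t t′
  occurrence-walk v∈ v∈′ with conn _ _ _ v∈ v∈′
  ... | p , (w , _) , vs = p , w , vs

  ∈-union-bag : ∀ {v t₁ t₂} → v ∈ χ t₁ ∪ χ t₂ → ∃ λ p → (p ≡ t₁ ⊎ p ≡ t₂) × v ∈ χ p
  ∈-union-bag {t₁ = t₁} {t₂} v∈ with x∈p∪q⁻ (χ t₁) (χ t₂) v∈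
  ... | inj₁ v∈t₁ = t₁ , inj₁ refl , v∈t₁
  ... | inj₂ v∈t₂ = t₂ , inj₂ refl , v∈t₂

  G⁺-walk : ∀ {a b ta tb} → G⁺ a b → a ∈ χ ta → b ∈ χ tb →
    WalkWithin adj (Meets (λ w → w ≡ a ⊎ w ≡ b)) ta tb
  G⁺-walk {a} {b} (_ , _ , _ , c , a∈ , b∈) a∈ta b∈tb
    with ∈-union-bag a∈ | ∈-union-bag b∈
  ... | pa , pa∈ , a∈pa | pb , pb∈ , b∈pb =
    WalkWithin-++ (WalkWithin-map (λ a∈q → a , inj₁ refl , a∈q) (occurrence-walk a∈ta a∈pa))
      (WalkWithin-++ (WalkWithin-map at-ends (Close⇒WalkWithin T (Close-among T pa∈ pb∈ c)))
        (WalkWithin-map (λ b∈q → b , inj₂ refl , b∈q) (occurrence-walk b∈pb b∈tb)))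
    where
    at-ends : ∀ {z} → z ≡ pa ⊎ z ≡ pb → Meets (λ w → w ≡ a ⊎ w ≡ b) z
    at-ends (inj₁ refl) = a , inj₁ refl , a∈pa
    at-ends (inj₂ refl) = b , inj₂ refl , b∈pb

  module Avoiding (S : Subset n) where

    Between : Fin n → Fin n → Fin n → Set
    Between a b w = ReachAvoid G⁺ S a w × ReachAvoid G⁺ S w b

    reach-walk : ∀ {a b ta tb} → ReachAvoid G⁺ S a b → a ∈ χ ta → b ∈ χ tb →
      WalkWithin adj (Meets (Between a b)) ta tb
    reach-walk r@(refl' a∉S) a∈ b∈ =
      WalkWithin-map (λ a∈q → _ , (refl' a∉S , r) , a∈q) (occurrence-walk a∈ b∈)
    reach-walk {a} r@(step' {y = c} a∉S e rest) a∈ b∈ with cover c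
    ... | tc , c∈ =
      WalkWithin-++
        (WalkWithin-map (Meets-pair (refl' a∉S , r) (a⇝c , rest)) (G⁺-walk e a∈ c∈))
        (WalkWithin-map (Meets-map λ { (c⇝w , w⇝b) → step' a∉S e c⇝w , w⇝b }) (reach-walk rest c∈ b∈))
      where
      a⇝c : ReachAvoid G⁺ S a c
      a⇝c = step' a∉S e (refl' (ReachAvoid-source∉ rest))

module MinimalSeparator (G : Graph) (T : Tree) (χ : Bags G T) (td : IsLenientTD G T χ)
    (S : Subset (Graph.n G)) (x y : Fin (Graph.n G))
    (minSep : IsMinimalSeparator (Completion G T χ) S x y) where
  open Graph G using (n)
  open Tree T using (m; adj; path)
  open IsLenientTD td using (cover)
  open LenientTD G T χ td
  open Avoiding S

  private
    x∉S : x ∉ S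
    x∉S = proj₁ (proj₁ minSep)

    y∉S : y ∉ S
    y∉S = proj₁ (proj₂ (proj₁ minSep))

    x↛y : ¬ ReachAvoid G⁺ S x y
    x↛y = proj₂ (proj₂ (proj₁ minSep))

    minimal : ∀ S′ → S′ ⊂ S → ¬ IsSeparator G⁺ S′ x y
    minimal = proj₂ minSep

    Cx : Fin n → Set
    Cx = ReachAvoid G⁺ S x

    tx ty : Fin m
    tx = proj₁ (cover x)
    ty = proj₁ (cover y)

    x∈tx : x ∈ χ tx
    x∈tx = proj₂ (cover x)

    y∈ty : y ∈ χ ty
    y∈ty = proj₂ (cover y)

    tx-ty-path : List (Fin m)
    tx-ty-path = proj₁ (path tx ty)

    tx-ty-isPath : IsPath adj tx ty tx-ty-path
    tx-ty-isPath = proj₂ (path tx ty)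

  ¬Meets-Cx-ty : ¬ Meets Cx ty
  ¬Meets-Cx-ty (w , x⇝w , w∈) with w ≟ y
  ... | yes refl = x↛y x⇝w
  ... | no  w≢y  = x↛y (ReachAvoid-via x⇝w (close-bags⇒G⁺ (inj₁ refl) w∈ y∈ty w≢y) (refl' y∉S))

  bag⊆separator : ∀ {q t} → adj q t → Meets Cx q → ¬ Meets Cx t → χ t ⊆ S
  bag⊆separator e (u , x⇝u , u∈) ¬Cx-t {w} w∈ with w ∈? S
  ... | yes w∈S = w∈S
  ... | no  w∉S with w ≟ u
  ...   | yes refl = ⊥-elim (¬Cx-t (w , x⇝u , w∈))
  ...   | no  w≢u  = ⊥-elim (¬Cx-t (w , x⇝w , w∈))
    where
    x⇝w : Cx w
    x⇝w = ReachAvoid-via x⇝u (close-bags⇒G⁺ (inj₂ e) u∈ w∈ (w≢u ∘ sym)) (refl' w∉S)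

  separator⊆bag : ∀ {t} → t ∈ₗ tx-ty-path → χ t ⊆ S → ¬ Meets Cx t → S ⊆ χ t
  separator⊆bag {t} t∈P χt⊆S ¬Cx-t {s} s∈S with s ∈? χ t
  ... | yes s∈t = s∈t
  ... | no  s∉t =
    ⊥-elim (minimal (S - s) S-s⊂S (x∉S ∘ proj₁ S-s⊂S , y∉S ∘ proj₁ S-s⊂S , x↛y-avoiding-S-s))
    where
    S-s⊂S : S - s ⊂ S
    S-s⊂S = x∈p⇒p-x⊂p s∈S

    Near : Fin n → Set
    Near w = Cx w ⊎ w ≡ s ⊎ ReachAvoid G⁺ S w y

    ¬Near-t : ¬ Meets Near t
    ¬Near-t (w , inj₁ x⇝w , w∈)         = ¬Cx-t (w , x⇝w , w∈)
    ¬Near-t (w , inj₂ (inj₁ refl) , w∈) = s∉t w∈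
    ¬Near-t (w , inj₂ (inj₂ w⇝y) , w∈)  = ReachAvoid-source∉ w⇝y (χt⊆S w∈)

    detour-walk : ∀ {u v} → Cx u → G⁺ u s → G⁺ s v → ReachAvoid G⁺ S v y →
      WalkWithin adj (Meets Near) tx ty
    detour-walk x⇝u us sv v⇝y with cover _ | cover s | cover _
    ... | _ , u∈ | _ , s∈ | _ , v∈ =
      WalkWithin-++ (WalkWithin-map (Meets-map (inj₁ ∘ proj₁)) (reach-walk x⇝u x∈tx u∈))
        (WalkWithin-++ (WalkWithin-map (Meets-pair (inj₁ x⇝u) (inj₂ (inj₁ refl))) (G⁺-walk us u∈ s∈))
          (WalkWithin-++ (WalkWithin-map (Meets-pair (inj₂ (inj₁ refl)) (inj₂ (inj₂ v⇝y))) (G⁺-walk sv s∈ v∈))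
            (WalkWithin-map (Meets-map (inj₂ ∘ inj₂ ∘ proj₂)) (reach-walk v⇝y v∈ y∈ty))))

    x↛y-avoiding-S-s : ¬ ReachAvoid G⁺ (S - s) x y
    x↛y-avoiding-S-s r
      with ReachAvoid-first-visit {S = S} {s} x∉S r | ReachAvoid-last-visit {S = S} {s} y∉S r
    ... | inj₁ x⇝y | _ = x↛y x⇝y
    ... | _ | inj₁ x⇝y = x↛y x⇝y
    ... | inj₂ (_ , x⇝u , us) | inj₂ (_ , sv , v⇝y) =
      ¬Near-t (All.lookup (WalkWithin⇒Path-within T tx-ty-isPath (detour-walk x⇝u us sv v⇝y)) t∈P)

  -- Reachability in G⁺ − S is not decidable, so the crossing edge exists only up to double negation.
  separator≡bag : ¬ ¬ ∃ λ t → S ≡ χ t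
  separator≡bag no-bag =
    Walk-crossing (proj₁ tx-ty-isPath) (x , refl' x∉S , x∈tx) ¬Meets-Cx-ty
      λ { (_ , t , e , Cx-q , ¬Cx-t , t∈P) →
            let χt⊆S = bag⊆separator e Cx-q ¬Cx-t
            in  no-bag (t , ⊆-antisym (separator⊆bag t∈P χt⊆S ¬Cx-t) χt⊆S) }

mainTheorem18 : (G : Graph) (T : Tree) (k : ℕ) (χ : Bags G T) →
    IsExtreme G T k χ →
    (S : Subset (Graph.n G)) (x y : Fin (Graph.n G)) →
    IsMinimalSeparator (Completion G T χ) S x y →
    ∃ λ t → S ≡ χ t
mainTheorem18 G T k χ extreme S x y minSep =
  decidable-stable (any? λ t → ≡-dec Bool._≟_ S (χ t))
    (MinimalSeparator.separator≡bag G T χ (IsExtreme.lenient extreme) S x y minSep)
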